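{- Let $\lambda>0$ and $\mu>0$ be real with $\mu\notin\{1,2\}$, such that $\mathfrak{V}_n(x;\lambda;\mu)$ is defined. For every nonnegative integer $n$ and real $x$, $$\mathfrak{V}_{n+1}(x;\lambda;\mu)-x\,\mathfrak{V}_{n}(x;\lambda;\mu)=\frac{1}{2-\mu}\sum_{i=0}^{n}\binom{n}{i}(n-i)!\left(\frac{\mu}{2(\mu-2)}\right)^{n-i}\left[\frac{\mu}{2}\mathfrak{V}_{i}(x;\lambda;\mu)-\lambda\sum_{k=0}^{i}\binom{i}{k}\mathfrak{V}_{k}(\lambda;\mu)\,\mathfrak{V}_{i-k}(x+1;\lambda;\mu)\right].$$
   Context: For real $\lambda>0$ and real $\mu\ge0$ with $\mu\ne1$, the unified Bernoulli-Euler polynomials of Apostol type are defined by the Taylor expansion at $t=0$ $$\frac{2-\mu+\frac{\mu}{2}t}{\lambda e^{t}+(1-\mu)}e^{xt}=\sum_{n\ge0}\mathfrak{V}_n(x;\lambda;\mu)\frac{t^n}{n!}.$$ This requires the left side to be holomorphic at $t=0$, i.e. $\lambda+1-\mu\ne0$ or $(\lambda,\mu)=(1,2)$. The numbers are $\mathfrak{V}_n(\lambda;\mu):=\mathfrak{V}_n(0;\lambda;\mu)$. -}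

module Defs where

open import Level using (Level)
open import Data.Nat using (ℕ; zero; suc; _∸_; _!)
open import Data.Nat.Combinatorics using (_C_)
open import Algebra.Bundles using (CommutativeRing)

-- Operations over an arbitrary commutative ring R (stand-in for ℝ).
module UBE {c ℓ : Level} (R : CommutativeRing c ℓ) where
  open CommutativeRing R hiding (zero)

  ⟦_⟧ : ℕ → Carrier
  ⟦ zero ⟧ = 0#
  ⟦ suc n ⟧ = 1# + ⟦ n ⟧

  two : Carrier
  two = 1# + 1#

  _^_ : Carrier → ℕ → Carrier
  a ^ zero = 1#
  a ^ suc n = a * (a ^ n)

  Σ≤ : ℕ → (ℕ → Carrier) → Carrier
  Σ≤ zero f = f zero
  Σ≤ (suc n) f = Σ≤ n f + f (suc n)

  -- The defining generating-function identity
  --   (λ e^t + (1-μ)) Σ_n V_n(x) t^n/n! = (2 - μ + (μ/2) t) e^{xt}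
  -- read coefficientwise (coefficient of t^n/n!):
  --   λ Σ_{k=0}^n C(n,k) V_k(x) + (1-μ) V_n(x) = (2-μ) x^n + (μ/2) n x^{n-1}
  -- (the last term is 0 for n = 0).  `i2` is the inverse of 2 used for μ/2.
  IsUBE : (λ' μ i2 : Carrier) → (Carrier → ℕ → Carrier) → Set (c Level.⊔ ℓ)
  IsUBE λ' μ i2 V = ∀ (x : Carrier) (n : ℕ) →
    λ' * Σ≤ n (λ k → ⟦ n C k ⟧ * V x k) + (1# - μ) * V x n
      ≈ (two - μ) * (x ^ n) + (μ * i2) * (⟦ n ⟧ * (x ^ (n ∸ 1)))

-- In exponential generating functions the defining relation reads V_x Q = e^{xt} P with
-- Q = λ e^t + 1 - μ and P = 2 - μ + (μ/2) t.  As Q(0) is a unit, Q can be cancelled, which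
-- first gives the Appell property V_x = V_0 e^{xt}.  Differentiating the relation shows that
-- W = V_x' - x V_x satisfies W Q = (μ/2) e^{xt} - λ e^t V_x; multiplying by P, using
-- e^t V_x P = V_0 e^{(x+1)t} P = V_0 V_{x+1} Q and cancelling Q gives W P = (μ/2) V_x - λ V_0 V_{x+1}.
-- Coefficientwise this is the first-order recurrence (2 - μ) W_n + (μ/2) n W_{n-1} = G_n,
-- and unrolling it yields the stated sum.
module Submission where

open import Defs
open import Level using (Level)
open import Data.Nat using (ℕ; suc; _∸_; _!)
open import Data.Nat.Combinatorics using (_C_)
open import Algebra.Bundles using (CommutativeRing)
open import Relation.Nullary using (¬_)

module FactorialBinomial where
  open import Data.Nat
  open import Data.Nat.Properties
  open import Data.Nat.DivMod using (_/_; m/n*n≡m)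
  open import Data.Nat.Combinatorics
  open import Relation.Binary.PropositionalEquality
  open ≡-Reasoning

  nCk*[n∸k]!k!≡n! : ∀ {n k} → k ≤ n → (n C k) * ((n ∸ k) ! * k !) ≡ n !
  nCk*[n∸k]!k!≡n! {n} {k} k≤n = begin
    (n C k) * ((n ∸ k) ! * k !)                             ≡⟨ cong ((n C k) *_) (*-comm ((n ∸ k) !) (k !)) ⟩
    (n C k) * (k ! * (n ∸ k) !)                             ≡⟨ cong (_* (k ! * (n ∸ k) !)) (nCk≡n!/k![n-k]! k≤n) ⟩
    (n ! / (k ! * (n ∸ k) !)) {{_}} * (k ! * (n ∸ k) !)     ≡⟨ m/n*n≡m {{k !* (n ∸ k) !≢0}} (k![n∸k]!∣n! k≤n) ⟩
    n !                                                      ∎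

  [1+n]Ci*[1+n∸i]!≡[1+n]*nCi*[n∸i]! : ∀ {n i} → i ≤ n →
    (suc n C i) * (suc n ∸ i) ! ≡ suc n * ((n C i) * (n ∸ i) !)
  [1+n]Ci*[1+n∸i]!≡[1+n]*nCi*[n∸i]! {n} {i} i≤n = *-cancelʳ-≡ _ _ (i !) {{i !≢0}} (begin
    (suc n C i) * (suc n ∸ i) ! * i !              ≡⟨ *-assoc (suc n C i) _ _ ⟩
    (suc n C i) * ((suc n ∸ i) ! * i !)            ≡⟨ nCk*[n∸k]!k!≡n! (m≤n⇒m≤1+n i≤n) ⟩
    suc n * n !                                    ≡⟨ cong (suc n *_) (nCk*[n∸k]!k!≡n! i≤n) ⟨
    suc n * ((n C i) * ((n ∸ i) ! * i !))          ≡⟨ cong (suc n *_) (*-assoc (n C i) ((n ∸ i) !) (i !)) ⟨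
    suc n * ((n C i) * (n ∸ i) ! * i !)            ≡⟨ *-assoc (suc n) ((n C i) * (n ∸ i) !) (i !) ⟨
    suc n * ((n C i) * (n ∸ i) !) * i !            ∎)

module ExponentialGeneratingFunctions {c ℓ : Level} (R : CommutativeRing c ℓ) where
  open CommutativeRing R hiding (zero)
  open UBE R
  open import Data.Nat as ℕ using (zero; _≤_; _<_; z≤n; s≤s)
  import Data.Nat.Properties as ℕ
  import Data.Nat.Combinatorics as ℕ
  open import Data.Nat.Induction using (<-rec)
  open import Relation.Binary.PropositionalEquality as ≡ using (_≡_)
  open FactorialBinomial using ([1+n]Ci*[1+n∸i]!≡[1+n]*nCi*[n∸i]!)
  open import Relation.Binary.Reasoning.Setoid setoid
  open import Algebra.Properties.Ring ring using (-‿distribˡ-*; -‿distribʳ-*; x∙y⁻¹≈ε⇒x≈y; x≈y⇒x∙y⁻¹≈ε; xyx⁻¹≈y; -‿+-comm; ⁻¹-anti-homo‿-; [y-z]x≈yx-zx)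
  open import Algebra.Properties.Semiring.Mult semiring using (_×_; ×-homo-+; ×1-homo-*)
  open import Algebra.Properties.CommutativeSemigroup +-commutativeSemigroup
    using () renaming (interchange to +-interchange; x∙yz≈y∙xz to x+[y+z]≈y+[x+z])
  open import Algebra.Properties.CommutativeSemigroup *-commutativeSemigroup
    using () renaming (interchange to *-interchange; x∙yz≈y∙xz to x*[y*z]≈y*[x*z]; x∙yz≈yx∙z to x*[y*z]≈y*x*z)
  open import Function using (_∘_)

  ⟦⟧≡×1# : ∀ n → ⟦ n ⟧ ≡ n × 1#
  ⟦⟧≡×1# zero = ≡.refl
  ⟦⟧≡×1# (suc n) = ≡.cong (1# +_) (⟦⟧≡×1# n)

  ⟦+⟧ : ∀ m n → ⟦ m ℕ.+ n ⟧ ≈ ⟦ m ⟧ + ⟦ n ⟧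
  ⟦+⟧ m n rewrite ⟦⟧≡×1# (m ℕ.+ n) | ⟦⟧≡×1# m | ⟦⟧≡×1# n = ×-homo-+ 1# m n

  ⟦*⟧ : ∀ m n → ⟦ m ℕ.* n ⟧ ≈ ⟦ m ⟧ * ⟦ n ⟧
  ⟦*⟧ m n rewrite ⟦⟧≡×1# (m ℕ.* n) | ⟦⟧≡×1# m | ⟦⟧≡×1# n = ×1-homo-* m n

  ⟦1⟧≈1# : ⟦ 1 ⟧ ≈ 1#
  ⟦1⟧≈1# = +-identityʳ 1#

  1#^≈1# : ∀ n → 1# ^ n ≈ 1#
  1#^≈1# zero = refl
  1#^≈1# (suc n) = trans (*-identityˡ _) (1#^≈1# n)

  Σ≤-cong : ∀ n {f g : ℕ → Carrier} → (∀ k → k ≤ n → f k ≈ g k) → Σ≤ n f ≈ Σ≤ n g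
  Σ≤-cong zero f≈g = f≈g 0 z≤n
  Σ≤-cong (suc n) f≈g = +-cong (Σ≤-cong n (λ k k≤n → f≈g k (ℕ.m≤n⇒m≤1+n k≤n))) (f≈g (suc n) ℕ.≤-refl)

  Σ≤-+ : ∀ n f g → Σ≤ n (λ k → f k + g k) ≈ Σ≤ n f + Σ≤ n g
  Σ≤-+ zero f g = refl
  Σ≤-+ (suc n) f g = trans (+-congʳ (Σ≤-+ n f g)) (+-interchange _ _ _ _)

  Σ≤-suc : ∀ n f → Σ≤ (suc n) f ≈ f 0 + Σ≤ n (λ k → f (suc k))
  Σ≤-suc zero f = refl
  Σ≤-suc (suc n) f = trans (+-congʳ (Σ≤-suc n f)) (+-assoc _ _ _)

  *-distribˡ-Σ≤ : ∀ n a f → a * Σ≤ n f ≈ Σ≤ n (λ k → a * f k)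
  *-distribˡ-Σ≤ zero a f = refl
  *-distribˡ-Σ≤ (suc n) a f = trans (distribˡ _ _ _) (+-congʳ (*-distribˡ-Σ≤ n a f))

  [x-y]+[z-w]≈[x+z]-[y+w] : ∀ x y z w → (x - y) + (z - w) ≈ (x + z) - (y + w)
  [x-y]+[z-w]≈[x+z]-[y+w] x y z w = trans (+-interchange x (- y) z (- w)) (+-congˡ (-‿+-comm y w))

  x+y≈z+w⇒x-z≈w-y : ∀ {x y z w} → x + y ≈ z + w → x - z ≈ w - y
  x+y≈z+w⇒x-z≈w-y {x} {y} {z} {w} x+y≈z+w = begin
    x - z            ≈⟨ xyx⁻¹≈y y (x - z) ⟨
    y + (x - z) - y  ≈⟨ +-congʳ (trans (+-congʳ (+-comm x y)) (+-assoc y x (- z))) ⟨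
    x + y - z - y    ≈⟨ +-congʳ (trans (+-congʳ x+y≈z+w) (xyx⁻¹≈y z w)) ⟩
    w - y            ∎

  Seq : Set c
  Seq = ℕ → Carrier

  infix 4 _≋_
  _≋_ : Seq → Seq → Set ℓ
  a ≋ b = ∀ n → a n ≈ b n

  ≋-refl : ∀ {a} → a ≋ a
  ≋-refl _ = refl

  ∂ : Seq → Seq
  ∂ a n = a (suc n)

  infixl 6 _⊕_ _⊖_
  infixl 7 _⋆_
  infixr 8 _·_

  _⊕_ _⊖_ : Seq → Seq → Seq
  (a ⊕ b) n = a n + b n
  (a ⊖ b) n = a n - b n

  _·_ : Carrier → Seq → Seq
  (k · a) n = k * a n

  -- The product of exponential generating functions, defined by the Leibniz rule
  -- ∂ (a ⋆ b) = ∂ a ⋆ b ⊕ a ⋆ ∂ b; see ⋆-binomial for the usual formula.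
  _⋆_ : Seq → Seq → Seq
  (a ⋆ b) zero = a zero * b zero
  (a ⋆ b) (suc n) = (∂ a ⋆ b) n + (a ⋆ ∂ b) n

  𝟘 𝟏 X : Seq
  𝟘 _ = 0#
  𝟏 zero = 1#
  𝟏 (suc _) = 0#
  X zero = 0#
  X (suc n) = 𝟏 n

  Exp : Carrier → Seq
  Exp x n = x ^ n

  ⋆-cong : ∀ {a a′ b b′} → a ≋ a′ → b ≋ b′ → a ⋆ b ≋ a′ ⋆ b′
  ⋆-cong a≋a′ b≋b′ zero = *-cong (a≋a′ 0) (b≋b′ 0)
  ⋆-cong a≋a′ b≋b′ (suc n) = +-cong (⋆-cong (a≋a′ ∘ suc) b≋b′ n) (⋆-cong a≋a′ (b≋b′ ∘ suc) n)

  ⋆-comm : ∀ a b → a ⋆ b ≋ b ⋆ a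
  ⋆-comm a b zero = *-comm _ _
  ⋆-comm a b (suc n) = trans (+-cong (⋆-comm (∂ a) b n) (⋆-comm a (∂ b) n)) (+-comm _ _)

  ⋆-distribˡ-⊕ : ∀ a b d → a ⋆ (b ⊕ d) ≋ a ⋆ b ⊕ a ⋆ d
  ⋆-distribˡ-⊕ a b d zero = distribˡ _ _ _
  ⋆-distribˡ-⊕ a b d (suc n) =
    trans (+-cong (⋆-distribˡ-⊕ (∂ a) b d n) (⋆-distribˡ-⊕ a (∂ b) (∂ d) n)) (+-interchange _ _ _ _)

  ⋆-distribʳ-⊕ : ∀ a b d → (b ⊕ d) ⋆ a ≋ b ⋆ a ⊕ d ⋆ a
  ⋆-distribʳ-⊕ a b d n =
    trans (⋆-comm (b ⊕ d) a n) (trans (⋆-distribˡ-⊕ a b d n) (+-cong (⋆-comm a b n) (⋆-comm a d n)))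

  ⋆-distribʳ-⊖ : ∀ a b d → (b ⊖ d) ⋆ a ≋ b ⋆ a ⊖ d ⋆ a
  ⋆-distribʳ-⊖ a b d zero = [y-z]x≈yx-zx _ _ _
  ⋆-distribʳ-⊖ a b d (suc n) =
    trans (+-cong (⋆-distribʳ-⊖ a (∂ b) (∂ d) n) (⋆-distribʳ-⊖ (∂ a) b d n)) ([x-y]+[z-w]≈[x+z]-[y+w] _ _ _ _)

  ⋆-scaleˡ : ∀ k a b → k · a ⋆ b ≋ k · (a ⋆ b)
  ⋆-scaleˡ k a b zero = *-assoc _ _ _
  ⋆-scaleˡ k a b (suc n) = trans (+-cong (⋆-scaleˡ k (∂ a) b n) (⋆-scaleˡ k a (∂ b) n)) (sym (distribˡ _ _ _))

  ⋆-scaleʳ : ∀ k a b → a ⋆ k · b ≋ k · (a ⋆ b)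
  ⋆-scaleʳ k a b n = trans (⋆-comm a (k · b) n) (trans (⋆-scaleˡ k b a n) (*-congˡ (⋆-comm b a n)))

  ⋆-linearʳ : ∀ k l a b d → (k · a ⊖ l · b) ⋆ d ≋ k · (a ⋆ d) ⊖ l · (b ⋆ d)
  ⋆-linearʳ k l a b d n =
    trans (⋆-distribʳ-⊖ d (k · a) (l · b) n) (+-cong (⋆-scaleˡ k a d n) (-‿cong (⋆-scaleˡ l b d n)))

  ⋆-assoc : ∀ a b d → (a ⋆ b) ⋆ d ≋ a ⋆ (b ⋆ d)
  ⋆-assoc a b d zero = *-assoc _ _ _
  ⋆-assoc a b d (suc n) = begin
    ((a ⋆ b) ⋆ d) (suc n)                                       ≈⟨ +-congʳ (⋆-distribʳ-⊕ d (∂ a ⋆ b) (a ⋆ ∂ b) n) ⟩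
    ((∂ a ⋆ b) ⋆ d) n + ((a ⋆ ∂ b) ⋆ d) n + ((a ⋆ b) ⋆ ∂ d) n   ≈⟨ +-cong (+-cong (⋆-assoc (∂ a) b d n) (⋆-assoc a (∂ b) d n))
                                                                          (⋆-assoc a b (∂ d) n) ⟩
    (∂ a ⋆ (b ⋆ d)) n + (a ⋆ (∂ b ⋆ d)) n + (a ⋆ (b ⋆ ∂ d)) n   ≈⟨ +-assoc _ _ _ ⟩
    (∂ a ⋆ (b ⋆ d)) n + ((a ⋆ (∂ b ⋆ d)) n + (a ⋆ (b ⋆ ∂ d)) n) ≈⟨ +-congˡ (⋆-distribˡ-⊕ a (∂ b ⋆ d) (b ⋆ ∂ d) n) ⟨
    (a ⋆ (b ⋆ d)) (suc n)                                       ∎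

  ⋆-rightComm : ∀ a b d → (a ⋆ b) ⋆ d ≋ (a ⋆ d) ⋆ b
  ⋆-rightComm a b d n = trans (⋆-assoc a b d n) (trans (⋆-cong ≋-refl (⋆-comm b d) n) (sym (⋆-assoc a d b n)))

  ⋆-zeroʳ : ∀ a → a ⋆ 𝟘 ≋ 𝟘
  ⋆-zeroʳ a zero = zeroʳ _
  ⋆-zeroʳ a (suc n) = trans (+-cong (⋆-zeroʳ (∂ a) n) (⋆-zeroʳ a n)) (+-identityʳ 0#)

  ⋆-identityʳ : ∀ a → a ⋆ 𝟏 ≋ a
  ⋆-identityʳ a zero = *-identityʳ _
  ⋆-identityʳ a (suc n) = trans (+-cong (⋆-identityʳ (∂ a) n) (⋆-zeroʳ a n)) (+-identityʳ _)

  ⋆-identityˡ : ∀ a → 𝟏 ⋆ a ≋ a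
  ⋆-identityˡ a n = trans (⋆-comm 𝟏 a n) (⋆-identityʳ a n)

  ⟦suc⟧*x≈x+⟦⟧*x : ∀ m x → ⟦ suc m ⟧ * x ≈ x + ⟦ m ⟧ * x
  ⟦suc⟧*x≈x+⟦⟧*x m x = trans (distribʳ x 1# ⟦ m ⟧) (+-congʳ (*-identityˡ x))

  ⋆-X : ∀ a n → (a ⋆ X) n ≈ ⟦ n ⟧ * a (n ∸ 1)
  ⋆-X a zero = trans (zeroʳ _) (sym (zeroˡ _))
  ⋆-X a (suc n) = trans (+-cong (⋆-X (∂ a) n) (⋆-identityʳ a n)) (leibniz n)
    where
    leibniz : ∀ n → ⟦ n ⟧ * ∂ a (n ∸ 1) + a n ≈ ⟦ suc n ⟧ * a n
    leibniz zero = trans (+-congʳ (zeroˡ _)) (trans (+-comm 0# _) (sym (trans (⟦suc⟧*x≈x+⟦⟧*x 0 _) (+-congˡ (zeroˡ _)))))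
    leibniz (suc m) = trans (+-comm _ _) (sym (⟦suc⟧*x≈x+⟦⟧*x (suc m) _))

  Exp-0# : Exp 0# ≋ 𝟏
  Exp-0# zero = refl
  Exp-0# (suc n) = zeroˡ _

  Exp-+ : ∀ x y → Exp (x + y) ≋ Exp x ⋆ Exp y
  Exp-+ x y zero = sym (*-identityˡ 1#)
  Exp-+ x y (suc n) = begin
    (x + y) * (x + y) ^ n                          ≈⟨ *-congˡ (Exp-+ x y n) ⟩
    (x + y) * (Exp x ⋆ Exp y) n                    ≈⟨ distribʳ _ _ _ ⟩
    x * (Exp x ⋆ Exp y) n + y * (Exp x ⋆ Exp y) n  ≈⟨ +-cong (⋆-scaleˡ x (Exp x) (Exp y) n) (⋆-scaleʳ y (Exp x) (Exp y) n) ⟨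
    (Exp x ⋆ Exp y) (suc n)                        ∎

  ⋆-binomial : ∀ a b n → (a ⋆ b) n ≈ Σ≤ n (λ k → ⟦ n C k ⟧ * a k * b (n ∸ k))
  ⋆-binomial a b zero = sym (*-congʳ (trans (*-congʳ ⟦1⟧≈1#) (*-identityˡ _)))
  ⋆-binomial a b (suc n) = begin
    (∂ a ⋆ b) n + (a ⋆ ∂ b) n                 ≈⟨ +-cong (⋆-binomial (∂ a) b n) (⋆-binomial a (∂ b) n) ⟩
    Σ≤ n L + Σ≤ n (λ k → ⟦ n C k ⟧ * a k * ∂ b (n ∸ k))
                                              ≈⟨ +-congˡ (trans (Σ≤-cong n (λ k k≤n → *-congˡ (reflexive (≡.cong b (≡.sym (ℕ.+-∸-assoc 1 k≤n))))))
                                                                (sym (trans (+-congˡ (T[1+n]≈0)) (+-identityʳ _)))) ⟩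
    Σ≤ n L + Σ≤ (suc n) T                     ≈⟨ +-congˡ (Σ≤-suc n T) ⟩
    Σ≤ n L + (F 0 + Σ≤ n U)                   ≈⟨ x+[y+z]≈y+[x+z] _ _ _ ⟩
    F 0 + (Σ≤ n L + Σ≤ n U)                   ≈⟨ +-congˡ (trans (Σ≤-cong n (λ k _ → pascal k)) (Σ≤-+ n L U)) ⟨
    F 0 + Σ≤ n (λ k → F (suc k))              ≈⟨ Σ≤-suc n F ⟨
    Σ≤ (suc n) F                              ∎
    where
    F T L U : ℕ → Carrier
    F k = ⟦ suc n C k ⟧ * a k * b (suc n ∸ k)
    T k = ⟦ n C k ⟧ * a k * b (suc n ∸ k)
    L k = ⟦ n C k ⟧ * a (suc k) * b (n ∸ k)
    U k = T (suc k)

    T[1+n]≈0 : T (suc n) ≈ 0#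
    T[1+n]≈0 rewrite ℕ.k>n⇒nCk≡0 (ℕ.n<1+n n) = trans (*-congʳ (zeroˡ _)) (zeroˡ _)

    pascal : ∀ k → F (suc k) ≈ L k + U k
    pascal k = begin
      ⟦ suc n C suc k ⟧ * a (suc k) * b (n ∸ k)                        ≈⟨ *-congʳ (*-congʳ (reflexive (≡.cong ⟦_⟧ (ℕ.nCk+nC[k+1]≡[n+1]C[k+1] n k)))) ⟨
      ⟦ n C k ℕ.+ n C suc k ⟧ * a (suc k) * b (n ∸ k)                   ≈⟨ *-congʳ (*-congʳ (⟦+⟧ (n C k) (n C suc k))) ⟩
      (⟦ n C k ⟧ + ⟦ n C suc k ⟧) * a (suc k) * b (n ∸ k)               ≈⟨ trans (*-congʳ (distribʳ _ _ _)) (distribʳ _ _ _) ⟩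
      L k + U k                                                        ∎

  ⋆-lowest : ∀ a b n → (∀ {m} → m < n → a m ≈ 0#) → (a ⋆ b) n ≈ a n * b 0
  ⋆-lowest a b zero _ = refl
  ⋆-lowest a b (suc n) a<n≈0 = begin
    (∂ a ⋆ b) n + (a ⋆ ∂ b) n    ≈⟨ +-cong (⋆-lowest (∂ a) b n (a<n≈0 ∘ s≤s)) (⋆-lowest a (∂ b) n (a<n≈0 ∘ ℕ.m<n⇒m<1+n)) ⟩
    a (suc n) * b 0 + a n * b 1  ≈⟨ +-congˡ (trans (*-congʳ (a<n≈0 ℕ.≤-refl)) (zeroˡ _)) ⟩
    a (suc n) * b 0 + 0#         ≈⟨ +-identityʳ _ ⟩
    a (suc n) * b 0              ∎

  -- Comparing the lowest nonzero coefficient of a ⊖ b shows that ⋆ q is injective when q 0 is a unit.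
  ⋆-cancelʳ : ∀ {q q⁻¹} → q⁻¹ * q 0 ≈ 1# → ∀ {a b} → a ⋆ q ≋ b ⋆ q → a ≋ b
  ⋆-cancelʳ {q} {q⁻¹} q⁻¹*q0≈1 {a} {b} a⋆q≋b⋆q n = x∙y⁻¹≈ε⇒x≈y (a n) (b n) (<-rec _ vanish n)
    where
    vanish : ∀ n → (∀ {m} → m < n → (a ⊖ b) m ≈ 0#) → (a ⊖ b) n ≈ 0#
    vanish n below = begin
      (a ⊖ b) n                ≈⟨ trans (*-congʳ q⁻¹*q0≈1) (*-identityˡ _) ⟨
      q⁻¹ * q 0 * (a ⊖ b) n    ≈⟨ trans (*-assoc _ _ _) (*-congˡ (*-comm _ _)) ⟩
      q⁻¹ * ((a ⊖ b) n * q 0)  ≈⟨ *-congˡ (⋆-lowest (a ⊖ b) q n below) ⟨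
      q⁻¹ * ((a ⊖ b) ⋆ q) n    ≈⟨ *-congˡ (trans (⋆-distribʳ-⊖ q a b n) (x≈y⇒x∙y⁻¹≈ε (a⋆q≋b⋆q n))) ⟩
      q⁻¹ * 0#                 ≈⟨ zeroʳ _ ⟩
      0#                       ∎

  -x*[y-z]≈x*[z-y] : ∀ x y z → - x * (y - z) ≈ x * (z - y)
  -x*[y-z]≈x*[z-y] x y z = trans (sym (-‿distribˡ-* x _)) (trans (-‿distribʳ-* x _) (*-congˡ (⁻¹-anti-homo‿- y z)))

  -x*y≈-[y*x] : ∀ x y → - x * y ≈ - (y * x)
  -x*y≈-[y*x] x y = trans (sym (-‿distribˡ-* x y)) (-‿cong (*-comm x y))

  solve-linear : ∀ {u α a b w z g} → u * a ≈ 1# → u * b ≈ - α →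
                 a * w + b * z ≈ g → w ≈ u * g + α * z
  solve-linear {u} {α} {a} {b} {w} {z} {g} u*a≈1 u*b≈-α aw+bz≈g = sym (begin
    u * g + α * z                    ≈⟨ +-congʳ (*-congˡ aw+bz≈g) ⟨
    u * (a * w + b * z) + α * z      ≈⟨ +-congʳ (trans (distribˡ u _ _) (sym (+-cong (*-assoc u a w) (*-assoc u b z)))) ⟩
    u * a * w + u * b * z + α * z    ≈⟨ +-congʳ (+-cong (*-congʳ u*a≈1) (*-congʳ u*b≈-α)) ⟩
    1# * w + - α * z + α * z         ≈⟨ +-assoc _ _ _ ⟩
    1# * w + (- α * z + α * z)       ≈⟨ +-cong (*-identityˡ w) (trans (+-congʳ (sym (-‿distribˡ-* α z))) (-‿inverseˡ _)) ⟩
    w + 0#                           ≈⟨ +-identityʳ w ⟩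
    w                                ∎)

  weight : Carrier → ℕ → ℕ → Carrier
  weight α n i = ⟦ n C i ⟧ * ⟦ (n ∸ i) ! ⟧ * (α ^ (n ∸ i))

  weight-diagonal : ∀ α n → weight α n n ≈ 1#
  weight-diagonal α n rewrite ℕ.nCn≡1 n | ℕ.n∸n≡0 n =
    trans (*-identityʳ _) (trans (*-cong ⟦1⟧≈1# ⟦1⟧≈1#) (*-identityʳ 1#))

  weight-suc : ∀ α {n i} → i ≤ n → weight α (suc n) i ≈ ⟦ suc n ⟧ * α * weight α n i
  weight-suc α {n} {i} i≤n = begin
    ⟦ suc n C i ⟧ * ⟦ (suc n ∸ i) ! ⟧ * α ^ (suc n ∸ i)      ≈⟨ *-cong (sym (⟦*⟧ (suc n C i) ((suc n ∸ i) !)))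
                                                                       (reflexive (≡.cong (α ^_) (ℕ.+-∸-assoc 1 i≤n))) ⟩
    ⟦ (suc n C i) ℕ.* (suc n ∸ i) ! ⟧ * (α * α ^ (n ∸ i))     ≈⟨ *-congʳ (reflexive (≡.cong ⟦_⟧ ([1+n]Ci*[1+n∸i]!≡[1+n]*nCi*[n∸i]! i≤n))) ⟩
    ⟦ suc n ℕ.* ((n C i) ℕ.* (n ∸ i) !) ⟧ * (α * α ^ (n ∸ i)) ≈⟨ *-congʳ (trans (⟦*⟧ (suc n) ((n C i) ℕ.* (n ∸ i) !)) (*-congˡ (⟦*⟧ (n C i) ((n ∸ i) !)))) ⟩
    ⟦ suc n ⟧ * (⟦ n C i ⟧ * ⟦ (n ∸ i) ! ⟧) * (α * α ^ (n ∸ i)) ≈⟨ *-interchange _ _ _ _ ⟩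
    ⟦ suc n ⟧ * α * weight α n i                               ∎

  linear-recurrence : ∀ u α (g w : Seq) → (∀ n → w n ≈ u * g n + α * (⟦ n ⟧ * w (n ∸ 1))) →
                      ∀ n → w n ≈ u * Σ≤ n (λ i → weight α n i * g i)
  linear-recurrence u α g w rec zero = begin
    w 0                          ≈⟨ rec 0 ⟩
    u * g 0 + α * (0# * w 0)     ≈⟨ +-congˡ (trans (*-congˡ (zeroˡ _)) (zeroʳ α)) ⟩
    u * g 0 + 0#                 ≈⟨ +-identityʳ _ ⟩
    u * g 0                      ≈⟨ *-congˡ (trans (*-congʳ (weight-diagonal α 0)) (*-identityˡ _)) ⟨
    u * (weight α 0 0 * g 0)     ∎
  linear-recurrence u α g w rec (suc n) = begin
    w (suc n)                                         ≈⟨ rec (suc n) ⟩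
    u * g (suc n) + α * (⟦ suc n ⟧ * w n)             ≈⟨ +-congˡ (*-congˡ (*-congˡ (linear-recurrence u α g w rec n))) ⟩
    u * g (suc n) + α * (⟦ suc n ⟧ * (u * S n))       ≈⟨ +-comm _ _ ⟩
    α * (⟦ suc n ⟧ * (u * S n)) + u * g (suc n)       ≈⟨ +-congʳ regroup ⟩
    u * (⟦ suc n ⟧ * α * S n) + u * g (suc n)         ≈⟨ distribˡ u _ _ ⟨
    u * (⟦ suc n ⟧ * α * S n + g (suc n))             ≈⟨ *-congˡ (+-cong (trans (*-distribˡ-Σ≤ n _ _) (Σ≤-cong n (λ i i≤n → step i≤n)))
                                                                     (sym (trans (*-congʳ (weight-diagonal α (suc n))) (*-identityˡ _)))) ⟩
    u * S (suc n)                                     ∎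
    where
    S : ℕ → Carrier
    S n = Σ≤ n (λ i → weight α n i * g i)

    regroup : α * (⟦ suc n ⟧ * (u * S n)) ≈ u * (⟦ suc n ⟧ * α * S n)
    regroup = begin
      α * (⟦ suc n ⟧ * (u * S n))  ≈⟨ *-congˡ (x*[y*z]≈y*[x*z] _ u _) ⟩
      α * (u * (⟦ suc n ⟧ * S n))  ≈⟨ x*[y*z]≈y*[x*z] α u _ ⟩
      u * (α * (⟦ suc n ⟧ * S n))  ≈⟨ *-congˡ (x*[y*z]≈y*x*z α _ _) ⟩
      u * (⟦ suc n ⟧ * α * S n)    ∎

    step : ∀ {i} → i ≤ n → ⟦ suc n ⟧ * α * (weight α n i * g i) ≈ weight α (suc n) i * g i
    step i≤n = trans (sym (*-assoc _ _ _)) (*-congʳ (sym (weight-suc α i≤n)))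

  module UnifiedBernoulliEuler (λ' μ i2 : Carrier) (V : Carrier → Seq) (isUBE : IsUBE λ' μ i2 V) where

    P Q : Seq
    P = (two - μ) · 𝟏 ⊕ (μ * i2) · X
    Q = λ' · Exp 1# ⊕ (1# - μ) · 𝟏

    ⋆-P : ∀ a n → (a ⋆ P) n ≈ (two - μ) * a n + (μ * i2) * (⟦ n ⟧ * a (n ∸ 1))
    ⋆-P a n = trans (⋆-distribˡ-⊕ a _ _ n)
      (+-cong (trans (⋆-scaleʳ _ a 𝟏 n) (*-congˡ (⋆-identityʳ a n)))
              (trans (⋆-scaleʳ _ a X n) (*-congˡ (⋆-X a n))))

    V⋆Q≋Exp⋆P : ∀ x → V x ⋆ Q ≋ Exp x ⋆ P
    V⋆Q≋Exp⋆P x n = begin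
      (V x ⋆ Q) n                                                ≈⟨ ⋆-distribˡ-⊕ (V x) _ _ n ⟩
      (V x ⋆ λ' · Exp 1#) n + (V x ⋆ (1# - μ) · 𝟏) n             ≈⟨ +-cong (⋆-scaleʳ λ' (V x) (Exp 1#) n) (⋆-scaleʳ (1# - μ) (V x) 𝟏 n) ⟩
      λ' * (V x ⋆ Exp 1#) n + (1# - μ) * (V x ⋆ 𝟏) n             ≈⟨ +-cong (*-congˡ (trans (⋆-binomial (V x) (Exp 1#) n) (Σ≤-cong n λ k _ →
                                                                               trans (*-congˡ (1#^≈1# (n ∸ k))) (*-identityʳ _))))
                                                                            (*-congˡ (⋆-identityʳ (V x) n)) ⟩
      λ' * Σ≤ n (λ k → ⟦ n C k ⟧ * V x k) + (1# - μ) * V x n     ≈⟨ isUBE x n ⟩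
      (two - μ) * x ^ n + (μ * i2) * (⟦ n ⟧ * x ^ (n ∸ 1))       ≈⟨ ⋆-P (Exp x) n ⟨
      (Exp x ⋆ P) n                                              ∎

    ∂Q≋λ'·Exp1 : ∂ Q ≋ λ' · Exp 1#
    ∂Q≋λ'·Exp1 n = trans (+-cong (*-congˡ (*-identityˡ _)) (zeroʳ _)) (+-identityʳ _)

    ∂P≋μi2·𝟏 : ∂ P ≋ (μ * i2) · 𝟏
    ∂P≋μi2·𝟏 n = trans (+-congʳ (zeroʳ _)) (+-identityˡ _)

    -- Differentiating V x ⋆ Q ≋ Exp x ⋆ P.
    shift⋆Q : ∀ x → (∂ (V x) ⊖ x · V x) ⋆ Q ≋ (μ * i2) · Exp x ⊖ λ' · (V x ⋆ Exp 1#)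
    shift⋆Q x n = begin
      ((∂ (V x) ⊖ x · V x) ⋆ Q) n          ≈⟨ ⋆-distribʳ-⊖ Q _ _ n ⟩
      (∂ (V x) ⋆ Q) n - (x · V x ⋆ Q) n    ≈⟨ +-congˡ (-‿cong (⋆-scaleˡ x (V x) Q n)) ⟩
      (∂ (V x) ⋆ Q) n - x * (V x ⋆ Q) n    ≈⟨ x+y≈z+w⇒x-z≈w-y leibniz ⟩
      (μ * i2) * x ^ n - λ' * (V x ⋆ Exp 1#) n ∎
      where
      leibniz : (∂ (V x) ⋆ Q) n + λ' * (V x ⋆ Exp 1#) n ≈ x * (V x ⋆ Q) n + (μ * i2) * x ^ n
      leibniz = begin
        (∂ (V x) ⋆ Q) n + λ' * (V x ⋆ Exp 1#) n     ≈⟨ +-congˡ (trans (⋆-cong ≋-refl ∂Q≋λ'·Exp1 n) (⋆-scaleʳ λ' (V x) (Exp 1#) n)) ⟨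
        (V x ⋆ Q) (suc n)                           ≈⟨ V⋆Q≋Exp⋆P x (suc n) ⟩
        (x · Exp x ⋆ P) n + (Exp x ⋆ ∂ P) n         ≈⟨ +-cong (⋆-scaleˡ x (Exp x) P n)
                                                               (trans (⋆-cong ≋-refl ∂P≋μi2·𝟏 n)
                                                               (trans (⋆-scaleʳ _ (Exp x) 𝟏 n) (*-congˡ (⋆-identityʳ (Exp x) n)))) ⟩
        x * (Exp x ⋆ P) n + (μ * i2) * x ^ n        ≈⟨ +-congʳ (*-congˡ (V⋆Q≋Exp⋆P x n)) ⟨
        x * (V x ⋆ Q) n + (μ * i2) * x ^ n          ∎

    module _ {q⁻¹ : Carrier} (q⁻¹*q0≈1 : q⁻¹ * (λ' + (1# - μ)) ≈ 1#) where

      ⋆Q-cancel : ∀ {a b} → a ⋆ Q ≋ b ⋆ Q → a ≋ b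
      ⋆Q-cancel = ⋆-cancelʳ (trans (*-congˡ (+-cong (*-identityʳ λ') (*-identityʳ _))) q⁻¹*q0≈1)

      appell : ∀ x → V x ≋ V 0# ⋆ Exp x
      appell x = ⋆Q-cancel λ n → begin
        (V x ⋆ Q) n                ≈⟨ V⋆Q≋Exp⋆P x n ⟩
        (Exp x ⋆ P) n              ≈⟨ ⋆-comm (Exp x) P n ⟩
        (P ⋆ Exp x) n              ≈⟨ ⋆-cong (λ m → trans (⋆-cong Exp-0# ≋-refl m) (⋆-identityˡ P m)) ≋-refl n ⟨
        ((Exp 0# ⋆ P) ⋆ Exp x) n   ≈⟨ ⋆-cong (V⋆Q≋Exp⋆P 0#) ≋-refl n ⟨
        ((V 0# ⋆ Q) ⋆ Exp x) n     ≈⟨ ⋆-rightComm (V 0#) (Exp x) Q n ⟨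
        ((V 0# ⋆ Exp x) ⋆ Q) n     ∎

      shift⋆P : ∀ x → (∂ (V x) ⊖ x · V x) ⋆ P ≋ (μ * i2) · V x ⊖ λ' · (V 0# ⋆ V (x + 1#))
      shift⋆P x = ⋆Q-cancel λ n → begin
        ((W ⋆ P) ⋆ Q) n                                            ≈⟨ ⋆-rightComm W P Q n ⟩
        ((W ⋆ Q) ⋆ P) n                                            ≈⟨ ⋆-cong (shift⋆Q x) ≋-refl n ⟩
        (((μ * i2) · Exp x ⊖ λ' · (V x ⋆ Exp 1#)) ⋆ P) n           ≈⟨ ⋆-linearʳ _ _ _ _ P n ⟩
        (μ * i2) * (Exp x ⋆ P) n - λ' * ((V x ⋆ Exp 1#) ⋆ P) n     ≈⟨ +-cong (*-congˡ (V⋆Q≋Exp⋆P x n)) (-‿cong (*-congˡ (rearrange n))) ⟨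
        (μ * i2) * (V x ⋆ Q) n - λ' * ((V 0# ⋆ V (x + 1#)) ⋆ Q) n  ≈⟨ ⋆-linearʳ _ _ _ _ Q n ⟨
        (((μ * i2) · V x ⊖ λ' · (V 0# ⋆ V (x + 1#))) ⋆ Q) n        ∎
        where
        W : Seq
        W = ∂ (V x) ⊖ x · V x

        rearrange : (V 0# ⋆ V (x + 1#)) ⋆ Q ≋ (V x ⋆ Exp 1#) ⋆ P
        rearrange n = begin
          ((V 0# ⋆ V (x + 1#)) ⋆ Q) n          ≈⟨ ⋆-assoc (V 0#) _ Q n ⟩
          (V 0# ⋆ (V (x + 1#) ⋆ Q)) n          ≈⟨ ⋆-cong ≋-refl (V⋆Q≋Exp⋆P (x + 1#)) n ⟩
          (V 0# ⋆ (Exp (x + 1#) ⋆ P)) n        ≈⟨ ⋆-cong ≋-refl (⋆-cong (Exp-+ x 1#) ≋-refl) n ⟩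
          (V 0# ⋆ ((Exp x ⋆ Exp 1#) ⋆ P)) n    ≈⟨ ⋆-assoc (V 0#) _ P n ⟨
          ((V 0# ⋆ (Exp x ⋆ Exp 1#)) ⋆ P) n    ≈⟨ ⋆-cong (⋆-assoc (V 0#) (Exp x) (Exp 1#)) ≋-refl n ⟨
          (((V 0# ⋆ Exp x) ⋆ Exp 1#) ⋆ P) n    ≈⟨ ⋆-cong (⋆-cong (appell x) ≋-refl) ≋-refl n ⟨
          ((V x ⋆ Exp 1#) ⋆ P) n               ∎

      shift-recurrence : ∀ x n →
        (two - μ) * (V x (suc n) - x * V x n) + (μ * i2) * (⟦ n ⟧ * (V x (suc (n ∸ 1)) - x * V x (n ∸ 1)))
          ≈ (μ * i2) * V x n - λ' * Σ≤ n (λ k → ⟦ n C k ⟧ * V 0# k * V (x + 1#) (n ∸ k))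
      shift-recurrence x n =
        trans (sym (⋆-P (∂ (V x) ⊖ x · V x) n)) (trans (shift⋆P x n) (+-congˡ (-‿cong (*-congˡ (⋆-binomial _ _ n)))))

theorem8 : ∀ {c ℓ : Level} (R : CommutativeRing c ℓ) →
  let open CommutativeRing R
      open UBE R
  in
  (λ' μ i2 iμ2 iD : Carrier) →
  i2 * two ≈ 1# →
  ¬ (μ ≈ 1#) →
  iμ2 * (μ - two) ≈ 1# →
  iD * (λ' + (1# - μ)) ≈ 1# →
  (V : Carrier → ℕ → Carrier) → IsUBE λ' μ i2 V →
  ∀ (n : ℕ) (x : Carrier) →
    V x (suc n) - x * V x n
      ≈ (- iμ2) * Σ≤ n (λ i →
          ⟦ n C i ⟧ * ⟦ (n ∸ i) ! ⟧ * ((μ * i2 * iμ2) ^ (n ∸ i))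
            * ((μ * i2) * V x i
               - λ' * Σ≤ i (λ k → ⟦ i C k ⟧ * V 0# k * V (x + 1#) (i ∸ k))))
theorem8 R λ' μ i2 iμ2 iD _ _ iμ2*[μ-2]≈1 iD*[λ'+1-μ]≈1 V isUBE n x =
  linear-recurrence (- iμ2) (μ * i2 * iμ2) G W
    (λ m → solve-linear (trans (-x*[y-z]≈x*[z-y] iμ2 two μ) iμ2*[μ-2]≈1) (-x*y≈-[y*x] iμ2 (μ * i2))
                        (shift-recurrence iD*[λ'+1-μ]≈1 x m))
    n
  where
  open CommutativeRing R
  open UBE R
  open ExponentialGeneratingFunctions R
  open UnifiedBernoulliEuler λ' μ i2 V isUBE

  W G : Seq
  W m = V x (suc m) - x * V x m
  G i = (μ * i2) * V x i - λ' * Σ≤ i (λ k → ⟦ i C k ⟧ * V 0# k * V (x + 1#) (i ∸ k))
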